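{- Let $n,m$ be positive integers with $\mathcal{C}_{n,m}$ nonempty. If $\mathcal{C}^{j}_{n,m}=\{G\}$ for some positive integer $j$ and $G$ is not $t$-optimal, then there is no uniformly most reliable graph in $\mathcal{C}_{n,m}$.
   Context: $\mathcal{C}_{n,m}$ is the class of connected simple graphs on $n$ vertices and $m$ edges (up to isomorphism). For $\rho\in[0,1]$, $R_G(\rho)$ is the probability that $G$ stays connected when each edge is removed independently with probability $\rho$. $G\in\mathcal{C}_{n,m}$ is a uniformly most reliable graph if $R_G(\rho)\ge R_H(\rho)$ for all $H\in\mathcal{C}_{n,m}$ and all $\rho\in[0,1]$. A $k$-edge-cut is a set $F$ of $k$ edges with $G-F$ disconnected; $\mu_k(G)$ is the number of $k$-edge-cuts of $G$. A graph $H\in\mathcal{C}_{n,m}$ is $t$-optimal if $\mu_{m-n+1}(H)\le\mu_{m-n+1}(G)$ for every $G\in\mathcal{C}_{n,m}$. Define $\mathcal{C}^0_{n,m}=\mathcal{C}_{n,m}$ and for $i\in\{0,\dots,m-1\}$, $\mathcal{C}^{i+1}_{n,m}=\{G\in\mathcal{C}^i_{n,m}:\mu_{i+1}(G)\le\mu_{i+1}(H)\ \forall H\in\mathcal{C}^i_{n,m}\}$. -}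

module Defs where

open import Data.Bool using (Bool; true; false; _∧_; _∨_; not; if_then_else_)
open import Data.Nat using (ℕ; zero; suc; _∸_; _<ᵇ_; _≡ᵇ_) renaming (_+_ to _+ℕ_; _≤_ to _≤ℕ_)
open import Data.Fin using (Fin; toℕ; _≟_)
open import Data.List using (List; []; _∷_; map; _++_; length; filterᵇ; allFin; concatMap; foldr)
open import Data.Bool.ListAction using (all; any)
import Data.List as L
open import Data.Vec using (Vec; []; _∷_; lookup; tabulate; zipWith)
open import Data.Product using (_×_; _,_; proj₁; proj₂; Σ; ∃)
open import Data.Rational using (ℚ; 0ℚ; 1ℚ; _+_; _*_; _-_; _≤_)
open import Data.Fin.Permutation using (Permutation′; _⟨$⟩ʳ_)
open import Relation.Binary.PropositionalEquality using (_≡_)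
open import Relation.Nullary using (does)

-- Potential edges of a simple graph on vertex set Fin n: unordered pairs {i,j}, i < j.
pairs : (n : ℕ) → List (Fin n × Fin n)
pairs n = concatMap (λ i → map (λ j → (i , j)) (filterᵇ (λ j → toℕ i <ᵇ toℕ j) (allFin n))) (allFin n)

N : ℕ → ℕ
N n = length (pairs n)

-- A (labelled) simple graph on Fin n: its edge set as a subset of the potential edges.
record Graph (n : ℕ) : Set where
  constructor mkGraph
  field
    edgeVec : Vec Bool (N n)
open Graph public

adj : {n : ℕ} → Graph n → Fin n → Fin n → Bool
adj {n} G u v = any (λ k → lookup (edgeVec G) k ∧ edgeIs (L.lookup (pairs n) k)) (allFin (N n))
  where
    edgeIs : Fin n × Fin n → Bool
    edgeIs (a , b) = (does (a ≟ u) ∧ does (b ≟ v)) ∨ (does (a ≟ v) ∧ does (b ≟ u))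

countT : {k : ℕ} → Vec Bool k → ℕ
countT [] = 0
countT (true ∷ v) = suc (countT v)
countT (false ∷ v) = countT v

edgeCount : {n : ℕ} → Graph n → ℕ
edgeCount G = countT (edgeVec G)

reach : {n : ℕ} → Graph n → Fin n → ℕ → Fin n → Bool
reach G u zero v = does (u ≟ v)
reach {n} G u (suc k) v = reach G u k v ∨ any (λ w → reach G u k w ∧ adj G w v) (allFin n)

-- connected: every two vertices are joined by a walk (length ≤ n suffices)
connected : {n : ℕ} → Graph n → Bool
connected {n} G = all (λ u → all (λ v → reach G u n v) (allFin n)) (allFin n)

subs : {k : ℕ} → Vec Bool k → List (Vec Bool k)
subs [] = [] ∷ []
subs (false ∷ v) = map (false ∷_) (subs v)
subs (true ∷ v) = map (false ∷_) (subs v) ++ map (true ∷_) (subs v)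

subgraphs : {n : ℕ} → Graph n → List (Graph n)
subgraphs G = map mkGraph (subs (edgeVec G))

-- μ k G : number of k-edge-cuts, i.e. edge sets F ⊆ E(G), |F| = k, with G - F disconnected
-- (F is encoded by the spanning subgraph S = G - F, |F| = |E(G)| - |E(S)|)
μ : {n : ℕ} → ℕ → Graph n → ℕ
μ k G = length (filterᵇ (λ S → not (connected S) ∧ ((edgeCount G ∸ edgeCount S) ≡ᵇ k)) (subgraphs G))

-- the class C_{n,m} (labelled representatives)
InC : (n m : ℕ) → Graph n → Set
InC n m G = (connected G ≡ true) × (edgeCount G ≡ m)

InCi : (n m : ℕ) → ℕ → Graph n → Set
InCi n m zero G = InC n m G
InCi n m (suc i) G = InCi n m i G × ((H : Graph n) → InCi n m i H → μ (suc i) G ≤ℕ μ (suc i) H)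

Iso : {n : ℕ} → Graph n → Graph n → Set
Iso {n} G H = Σ (Permutation′ n) λ σ → (u v : Fin n) → adj G u v ≡ adj H (σ ⟨$⟩ʳ u) (σ ⟨$⟩ʳ v)

TOptimal : (n m : ℕ) → Graph n → Set
TOptimal n m H = (G : Graph n) → InC n m G → μ (m ∸ n +ℕ 1) H ≤ℕ μ (m ∸ n +ℕ 1) G

_^ℚ_ : ℚ → ℕ → ℚ
x ^ℚ zero = 1ℚ
x ^ℚ suc k = x * (x ^ℚ k)

-- R_G(ρ): probability that G stays connected when each edge is removed independently
-- with probability ρ = Σ over surviving edge sets S ⊆ E(G) with S connected of
-- ρ^{|E(G) \ S|} (1-ρ)^{|S|}
R : {n : ℕ} → Graph n → ℚ → ℚ
R G ρ = foldr _+_ 0ℚ (map term (subgraphs G))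
  where
    term : Graph _ → ℚ
    term S = if connected S then (ρ ^ℚ (edgeCount G ∸ edgeCount S)) * ((1ℚ - ρ) ^ℚ edgeCount S) else 0ℚ

-- uniformly most reliable in C_{n,m} (ρ ranging over rationals in [0,1])
UMR : (n m : ℕ) → Graph n → Set
UMR n m G = InC n m G × ((H : Graph n) → InC n m H → (ρ : ℚ) → 0ℚ ≤ ρ → ρ ≤ 1ℚ → R H ρ ≤ R G ρ)

-- If U were uniformly most reliable, compare R_H ≤ R_U at the rational points ρ = 1/(1+y) and ρ = y/(1+y)
-- for all natural y. Writing nonCuts k X for the number of k-edge sets whose removal leaves X connected,
-- (1+y)^m R_X(ρ) is the polynomial Σ_k nonCuts k X y^(m-k), resp. Σ_k nonCuts k X y^k, and an inequality
-- between such polynomials for all large y forces the coefficients to compare lexicographically from the top.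
-- Since μ k X + nonCuts k X = C(m, k), the first comparison puts U into every C^i (i ≤ m), and the second
-- makes U t-optimal, because nonCuts k X = 0 for k > m - n + 1 (a connected graph on n vertices keeps at
-- least n - 1 edges). So G ≅ U, and as μ is invariant under isomorphism, G would be t-optimal.

module Submission where

open import Defs
open import Data.Nat using (ℕ; _≤_)
open import Data.Product using (_×_; Σ; ∃; _,_)
open import Relation.Nullary using (¬_)

module Counting where

  open import Data.Bool using (Bool; true; false; _∧_; not; T)
  open import Data.Nat
  open import Data.Nat.Properties
  open import Data.List using (List; []; _∷_; map; _++_; length; filterᵇ)
  open import Data.List.Relation.Unary.All as All using (All; []; _∷_)
  open import Relation.Binary.PropositionalEquality
  import Data.List.Properties as ListP
  open import Data.List.Membership.Propositional using (_∈_; lose)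
  open import Relation.Nullary.Decidable using (T?)
  open import Function using (_∘_)
  open import Data.Empty using (⊥-elim)

  T-injective : {a b : Bool} → (T a → T b) → (T b → T a) → a ≡ b
  T-injective {false} {false} _ _ = refl
  T-injective {false} {true}  _ f = ⊥-elim (f _)
  T-injective {true}  {false} f _ = ⊥-elim (f _)
  T-injective {true}  {true}  _ _ = refl

  countᵇ : {A : Set} → (A → Bool) → List A → ℕ
  countᵇ p xs = length (filterᵇ p xs)

  module _ {A : Set} where

    countᵇ-++ : (p : A → Bool) (xs ys : List A) → countᵇ p (xs ++ ys) ≡ countᵇ p xs + countᵇ p ys
    countᵇ-++ p [] ys = refl
    countᵇ-++ p (x ∷ xs) ys with p x
    ... | true  = cong suc (countᵇ-++ p xs ys)
    ... | false = countᵇ-++ p xs ys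

    countᵇ-map : {B : Set} (p : B → Bool) (f : A → B) (xs : List A) → countᵇ p (map f xs) ≡ countᵇ (λ x → p (f x)) xs
    countᵇ-map p f [] = refl
    countᵇ-map p f (x ∷ xs) with p (f x)
    ... | true  = cong suc (countᵇ-map p f xs)
    ... | false = countᵇ-map p f xs

    countᵇ-congᴬ : {p q : A → Bool} {xs : List A} → All (λ x → p x ≡ q x) xs → countᵇ p xs ≡ countᵇ q xs
    countᵇ-congᴬ [] = refl
    countᵇ-congᴬ {p} {q} {x ∷ xs} (_ ∷ eqs) with p x | q x
    ... | true  | true  = cong suc (countᵇ-congᴬ eqs)
    ... | false | false = countᵇ-congᴬ eqs

    countᵇ-partition : (p q : A → Bool) (xs : List A) →
                       countᵇ (λ x → not (p x) ∧ q x) xs + countᵇ (λ x → p x ∧ q x) xs ≡ countᵇ q xs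
    countᵇ-partition p q [] = refl
    countᵇ-partition p q (x ∷ xs) with p x | q x
    ... | true  | true  = trans (+-suc _ _) (cong suc (countᵇ-partition p q xs))
    ... | false | true  = cong suc (countᵇ-partition p q xs)
    ... | true  | false = countᵇ-partition p q xs
    ... | false | false = countᵇ-partition p q xs

    countᵇ-none : (xs : List A) → countᵇ (λ _ → false) xs ≡ 0
    countᵇ-none []       = refl
    countᵇ-none (x ∷ xs) = countᵇ-none xs

    countᵇ-cong : {p q : A → Bool} → (∀ x → p x ≡ q x) → (xs : List A) → countᵇ p xs ≡ countᵇ q xs
    countᵇ-cong p≗q xs = countᵇ-congᴬ (All.universal p≗q xs)

    countᵇ-pos : {p : A → Bool} {x : A} {xs : List A} → x ∈ xs → T (p x) → 0 < countᵇ p xs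
    countᵇ-pos {p} x∈xs px = ListP.filter-some (T? ∘ p) (lose x∈xs px)

open Counting

module Polynomials where

  open import Data.Bool using (Bool; true; false; _∧_; if_then_else_)
  open import Data.Nat
  open import Data.Nat.Properties
  open import Data.Nat.ListAction using (sum)
  open import Data.List using (List; []; _∷_; map)
  open import Data.List.Relation.Unary.All using (All; []; _∷_)
  open import Data.Sum using (inj₁; inj₂)
  open import Relation.Nullary using (yes; no; contradiction)
  open import Relation.Nullary.Decidable using (dec-true; dec-false)
  open import Relation.Binary.PropositionalEquality
  open import Algebra.Properties.CommutativeSemigroup +-commutativeSemigroup
    using () renaming (interchange to +-interchange)

  ∑≤ : ℕ → (ℕ → ℕ) → ℕ
  ∑≤ zero    f = f 0
  ∑≤ (suc M) f = f (suc M) + ∑≤ M f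

  ∑≤-cong : ∀ M {f g : ℕ → ℕ} → (∀ k → k ≤ M → f k ≡ g k) → ∑≤ M f ≡ ∑≤ M g
  ∑≤-cong zero    f≗g = f≗g 0 z≤n
  ∑≤-cong (suc M) f≗g = cong₂ _+_ (f≗g (suc M) ≤-refl) (∑≤-cong M (λ k k≤M → f≗g k (m≤n⇒m≤1+n k≤M)))

  ∑≤-zero : ∀ M {f : ℕ → ℕ} → (∀ k → k ≤ M → f k ≡ 0) → ∑≤ M f ≡ 0
  ∑≤-zero zero    f≗0 = f≗0 0 z≤n
  ∑≤-zero (suc M) f≗0 = cong₂ _+_ (f≗0 (suc M) ≤-refl) (∑≤-zero M (λ k k≤M → f≗0 k (m≤n⇒m≤1+n k≤M)))

  ∑≤-distrib-+ : ∀ M (f g : ℕ → ℕ) → ∑≤ M (λ k → f k + g k) ≡ ∑≤ M f + ∑≤ M g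
  ∑≤-distrib-+ zero    f g = refl
  ∑≤-distrib-+ (suc M) f g =
    trans (cong (f (suc M) + g (suc M) +_) (∑≤-distrib-+ M f g))
          (+-interchange (f (suc M)) (g (suc M)) (∑≤ M f) (∑≤ M g))

  ∑≤-reverse : ∀ M (f : ℕ → ℕ) → ∑≤ M (λ k → f (M ∸ k)) ≡ ∑≤ M f
  ∑≤-reverse zero    f = refl
  ∑≤-reverse (suc M) f = begin
    f (M ∸ M) + ∑≤ M (λ k → f (suc M ∸ k)) ≡⟨ cong₂ _+_ (cong f (n∸n≡0 M))
                                                     (∑≤-cong M (λ k k≤M → cong f (+-∸-assoc 1 k≤M))) ⟩
    f 0 + ∑≤ M (λ k → f (suc (M ∸ k)))     ≡⟨ cong (f 0 +_) (∑≤-reverse M (λ k → f (suc k))) ⟩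
    f 0 + ∑≤ M (λ k → f (suc k))           ≡⟨ +-comm (f 0) _ ⟩
    ∑≤ M (λ k → f (suc k)) + f 0           ≡⟨ shift M ⟨
    ∑≤ (suc M) f                           ∎
    where
    open ≡-Reasoning
    shift : ∀ M → ∑≤ (suc M) f ≡ ∑≤ M (λ k → f (suc k)) + f 0
    shift zero    = refl
    shift (suc M) = trans (cong (f (2 + M) +_) (shift M)) (sym (+-assoc (f (2 + M)) _ (f 0)))

  -- does (m ≟ n) is m ≡ᵇ n by the definition of _≟_ on ℕ, so dec-true/dec-false rewrite the tests below.
  ∑≤-indicator : ∀ M (g : ℕ → ℕ) {h} → h ≤ M → ∑≤ M (λ k → if h ≡ᵇ k then g k else 0) ≡ g h
  ∑≤-indicator zero    g z≤n = refl
  ∑≤-indicator (suc M) g {h} h≤1+M with m≤n⇒m<n∨m≡n h≤1+M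
  ... | inj₂ refl rewrite dec-true (h ≟ h) refl =
    trans (cong (g h +_) (∑≤-zero M off)) (+-identityʳ (g h))
    where
    off : ∀ k → k ≤ M → (if suc M ≡ᵇ k then g k else 0) ≡ 0
    off k k≤M rewrite dec-false (suc M ≟ k) (λ { refl → 1+n≰n k≤M }) = refl
  ... | inj₁ (s≤s h≤M) rewrite dec-false (h ≟ suc M) (λ { refl → <-irrefl refl (s≤s h≤M) }) =
    ∑≤-indicator M g h≤M

  ∑-groupBy : {A : Set} (p : A → Bool) (h : A → ℕ) (g : ℕ → ℕ) {M : ℕ} {xs : List A} → All (λ x → h x ≤ M) xs →
              sum (map (λ x → if p x then g (h x) else 0) xs) ≡ ∑≤ M (λ k → countᵇ (λ x → p x ∧ (h x ≡ᵇ k)) xs * g k)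
  ∑-groupBy p h g {M} [] = sym (∑≤-zero M (λ _ _ → refl))
  ∑-groupBy p h g {M} {x ∷ xs} (hx≤M ∷ h≤M) = begin
    (if p x then g (h x) else 0) + sum (map (λ x → if p x then g (h x) else 0) xs)
      ≡⟨ cong₂ _+_ head (∑-groupBy p h g h≤M) ⟩
    ∑≤ M (λ k → if p x ∧ (h x ≡ᵇ k) then g k else 0) + ∑≤ M (λ k → countᵇ (λ x → p x ∧ (h x ≡ᵇ k)) xs * g k)
      ≡⟨ ∑≤-distrib-+ M _ _ ⟨
    ∑≤ M (λ k → (if p x ∧ (h x ≡ᵇ k) then g k else 0) + countᵇ (λ x → p x ∧ (h x ≡ᵇ k)) xs * g k)
      ≡⟨ ∑≤-cong M (λ k _ → step k) ⟩
    ∑≤ M (λ k → countᵇ (λ x → p x ∧ (h x ≡ᵇ k)) (x ∷ xs) * g k) ∎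
    where
    open ≡-Reasoning
    head : (if p x then g (h x) else 0) ≡ ∑≤ M (λ k → if p x ∧ (h x ≡ᵇ k) then g k else 0)
    head with p x
    ... | true  = sym (∑≤-indicator M g hx≤M)
    ... | false = sym (∑≤-zero M (λ _ _ → refl))
    step : ∀ k → (if p x ∧ (h x ≡ᵇ k) then g k else 0) + countᵇ (λ x → p x ∧ (h x ≡ᵇ k)) xs * g k
               ≡ countᵇ (λ x → p x ∧ (h x ≡ᵇ k)) (x ∷ xs) * g k
    step k with p x ∧ (h x ≡ᵇ k)
    ... | true  = refl
    ... | false = refl

  poly : ℕ → (ℕ → ℕ) → ℕ → ℕ
  poly M a y = ∑≤ M (λ k → a k * y ^ k)

  poly≤coeffSum*y^deg : ∀ M a y → poly M a (suc y) ≤ ∑≤ M a * suc y ^ M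
  poly≤coeffSum*y^deg zero    a y = ≤-refl
  poly≤coeffSum*y^deg (suc M) a y = begin
    a (suc M) * Y ^ suc M + poly M a Y
      ≤⟨ +-monoʳ-≤ (a (suc M) * Y ^ suc M) (poly≤coeffSum*y^deg M a y) ⟩
    a (suc M) * Y ^ suc M + ∑≤ M a * Y ^ M
      ≤⟨ +-monoʳ-≤ (a (suc M) * Y ^ suc M) (*-monoʳ-≤ (∑≤ M a) (^-monoʳ-≤ Y (n≤1+n M))) ⟩
    a (suc M) * Y ^ suc M + ∑≤ M a * Y ^ suc M
      ≡⟨ *-distribʳ-+ (Y ^ suc M) (a (suc M)) (∑≤ M a) ⟨
    ∑≤ (suc M) a * Y ^ suc M ∎
    where
    Y : ℕ
    Y = suc y
    open ≤-Reasoning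

  -- Evaluate at y = 1 + (sum of the lower coefficients of a): there the leading term dominates the rest.
  poly-≤⇒leading-≤ : ∀ M a b → (∀ y → poly M b y ≤ poly M a y) → b M ≤ a M
  poly-≤⇒leading-≤ zero    a b b≤a = subst₂ _≤_ (*-identityʳ (b 0)) (*-identityʳ (a 0)) (b≤a 0)
  poly-≤⇒leading-≤ (suc M) a b b≤a with b (suc M) ≤? a (suc M)
  ... | yes bM≤aM = bM≤aM
  ... | no  bM≰aM = contradiction (b≤a Y) (<⇒≱ a<b)
    where
    A Y : ℕ
    A = ∑≤ M a
    Y = suc A
    a<b : poly (suc M) a Y < poly (suc M) b Y
    a<b = begin-strict
      a (suc M) * Y ^ suc M + poly M a Y
        ≤⟨ +-monoʳ-≤ (a (suc M) * Y ^ suc M) (poly≤coeffSum*y^deg M a A) ⟩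
      a (suc M) * Y ^ suc M + A * Y ^ M
        <⟨ +-monoʳ-< (a (suc M) * Y ^ suc M) (*-monoˡ-< (Y ^ M) {{m^n≢0 Y M}} (n<1+n A)) ⟩
      a (suc M) * Y ^ suc M + Y ^ suc M  ≡⟨ +-comm (a (suc M) * Y ^ suc M) _ ⟩
      suc (a (suc M)) * Y ^ suc M        ≤⟨ *-monoˡ-≤ (Y ^ suc M) (≰⇒> bM≰aM) ⟩
      b (suc M) * Y ^ suc M              ≤⟨ m≤m+n _ _ ⟩
      poly (suc M) b Y                   ∎
      where open ≤-Reasoning

  poly-≤⇒coeff-≤ : ∀ M i a b → i ≤ M → (∀ y → poly M b y ≤ poly M a y) →
                   (∀ k → i < k → k ≤ M → a k ≡ b k) → b i ≤ a i
  poly-≤⇒coeff-≤ M i a b i≤M b≤a a≡b with m≤n⇒m<n∨m≡n i≤M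
  ... | inj₂ refl = poly-≤⇒leading-≤ i a b b≤a
  poly-≤⇒coeff-≤ (suc M) i a b _ b≤a a≡b | inj₁ (s≤s i≤M) =
    poly-≤⇒coeff-≤ M i a b i≤M truncated (λ k i<k k≤M → a≡b k i<k (m≤n⇒m≤1+n k≤M))
    where
    truncated : ∀ y → poly M b y ≤ poly M a y
    truncated y = +-cancelˡ-≤ (a (suc M) * y ^ suc M) _ _
      (subst (λ c → c * y ^ suc M + poly M b y ≤ a (suc M) * y ^ suc M + poly M a y)
             (sym (a≡b (suc M) (s≤s i≤M) ≤-refl)) (b≤a y))

open Polynomials

module Subsets where

  open import Data.Bool using (Bool; true; false; T)
  open import Data.Nat
  open import Data.Nat.Properties
  open import Data.Nat.Combinatorics using (_C_; nCk+nC[k+1]≡[n+1]C[k+1])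
  open import Data.Fin using (zero; suc)
  open import Data.List using ([]; _∷_; map; _++_)
  open import Data.List.Relation.Unary.All as All using (All; []; _∷_)
  import Data.List.Relation.Unary.All.Properties as All
  open import Data.List.Relation.Unary.Any using (here)
  open import Data.List.Membership.Propositional using (_∈_)
  open import Data.List.Membership.Propositional.Properties using (∈-map⁺; ∈-map⁻; ∈-++⁺ˡ; ∈-++⁺ʳ; ∈-++⁻)
  open import Data.List.Relation.Unary.Unique.Propositional using (Unique)
  import Data.List.Relation.Unary.AllPairs as AllPairs
  import Data.List.Relation.Unary.Unique.Propositional.Properties as Unique
  open import Data.Vec using (Vec; []; _∷_; lookup)
  open import Data.Vec.Properties using (∷-injectiveʳ)
  open import Data.Product using (_×_; _,_)
  open import Data.Sum using (inj₁; inj₂)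
  open import Function using (_∘_)
  open import Relation.Nullary using (¬_)
  open import Data.Empty using (⊥-elim)
  open import Relation.Binary.PropositionalEquality

  _⊆ᵛ_ : {M : ℕ} → Vec Bool M → Vec Bool M → Set
  w ⊆ᵛ v = ∀ i → T (lookup w i) → T (lookup v i)

  subs-countT≤ : ∀ {M} (v : Vec Bool M) → All (λ w → countT w ≤ countT v) (subs v)
  subs-countT≤ []          = z≤n ∷ []
  subs-countT≤ (false ∷ v) = All.map⁺ (subs-countT≤ v)
  subs-countT≤ (true ∷ v)  = All.++⁺ (All.map⁺ (All.map m≤n⇒m≤1+n (subs-countT≤ v)))
                                     (All.map⁺ (All.map s≤s (subs-countT≤ v)))

  ∈-subs-self : ∀ {M} (v : Vec Bool M) → v ∈ subs v
  ∈-subs-self []          = here refl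
  ∈-subs-self (false ∷ v) = ∈-map⁺ (false ∷_) (∈-subs-self v)
  ∈-subs-self (true ∷ v)  = ∈-++⁺ʳ (map (false ∷_) (subs v)) (∈-map⁺ (true ∷_) (∈-subs-self v))

  subs-binomial : ∀ {M} (v : Vec Bool M) k →
                  countᵇ (λ w → (countT v ∸ countT w) ≡ᵇ k) (subs v) ≡ countT v C k
  subs-binomial []          zero    = refl
  subs-binomial []          (suc k) = refl
  subs-binomial (false ∷ v) k       = trans (countᵇ-map _ (false ∷_) (subs v)) (subs-binomial v k)
  subs-binomial (true ∷ v)  k       = begin
    countᵇ q (map (false ∷_) (subs v) ++ map (true ∷_) (subs v))
      ≡⟨ countᵇ-++ q (map (false ∷_) (subs v)) (map (true ∷_) (subs v)) ⟩
    countᵇ q (map (false ∷_) (subs v)) + countᵇ q (map (true ∷_) (subs v))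
      ≡⟨ cong₂ _+_ (countᵇ-map q (false ∷_) (subs v)) (countᵇ-map q (true ∷_) (subs v)) ⟩
    countᵇ (λ w → (suc e ∸ countT w) ≡ᵇ k) (subs v) + countᵇ (λ w → (e ∸ countT w) ≡ᵇ k) (subs v)
      ≡⟨ cong (_+ countᵇ (λ w → (e ∸ countT w) ≡ᵇ k) (subs v))
              (countᵇ-congᴬ (All.map (λ w≤e → cong (_≡ᵇ k) (+-∸-assoc 1 w≤e)) (subs-countT≤ v))) ⟩
    countᵇ (λ w → suc (e ∸ countT w) ≡ᵇ k) (subs v) + countᵇ (λ w → (e ∸ countT w) ≡ᵇ k) (subs v)
      ≡⟨ pascal k ⟩
    suc e C k ∎
    where
    open ≡-Reasoning
    e : ℕ
    e = countT v
    q : Vec Bool _ → Bool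
    q w = (countT (true ∷ v) ∸ countT w) ≡ᵇ k
    pascal : ∀ k → countᵇ (λ w → suc (e ∸ countT w) ≡ᵇ k) (subs v) + countᵇ (λ w → (e ∸ countT w) ≡ᵇ k) (subs v)
                   ≡ suc e C k
    pascal zero    = trans (cong (_+ countᵇ (λ w → (e ∸ countT w) ≡ᵇ 0) (subs v)) (countᵇ-none (subs v)))
                           (subs-binomial v 0)
    pascal (suc k) = trans (cong₂ _+_ (subs-binomial v k) (subs-binomial v (suc k))) (nCk+nC[k+1]≡[n+1]C[k+1] e k)

  subs-unique : ∀ {M} (v : Vec Bool M) → Unique (subs v)
  subs-unique []          = All.[] AllPairs.∷ AllPairs.[]
  subs-unique (false ∷ v) = Unique.map⁺ ∷-injectiveʳ (subs-unique v)
  subs-unique (true ∷ v)  = Unique.++⁺ (Unique.map⁺ ∷-injectiveʳ (subs-unique v))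
                                       (Unique.map⁺ ∷-injectiveʳ (subs-unique v)) heads-differ
    where
    heads-differ : ∀ {w} → ¬ (w ∈ map (false ∷_) (subs v) × w ∈ map (true ∷_) (subs v))
    heads-differ (w∈F , w∈T) with ∈-map⁻ (false ∷_) w∈F | ∈-map⁻ (true ∷_) w∈T
    ... | _ , _ , refl | _ , _ , ()

  ∈-subs⁻ : ∀ {M} (w v : Vec Bool M) → w ∈ subs v → w ⊆ᵛ v
  ∈-subs⁻ w [] _ ()
  ∈-subs⁻ w (false ∷ v) w∈ i with ∈-map⁻ (false ∷_) w∈
  ∈-subs⁻ w (false ∷ v) w∈ (suc i) | w′ , w′∈ , refl = ∈-subs⁻ w′ v w′∈ i
  ∈-subs⁻ w (true ∷ v) w∈ zero    _ = _
  ∈-subs⁻ w (true ∷ v) w∈ (suc i) with ∈-++⁻ (map (false ∷_) (subs v)) w∈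
  ... | inj₁ w∈F with ∈-map⁻ (false ∷_) w∈F
  ...   | w′ , w′∈ , refl = ∈-subs⁻ w′ v w′∈ i
  ∈-subs⁻ w (true ∷ v) w∈ (suc i) | inj₂ w∈T with ∈-map⁻ (true ∷_) w∈T
  ...   | w′ , w′∈ , refl = ∈-subs⁻ w′ v w′∈ i

  ∈-subs⁺ : ∀ {M} (w v : Vec Bool M) → w ⊆ᵛ v → w ∈ subs v
  ∈-subs⁺ [] [] _ = here refl
  ∈-subs⁺ (false ∷ w) (false ∷ v) w⊆v = ∈-map⁺ (false ∷_) (∈-subs⁺ w v (w⊆v ∘ suc))
  ∈-subs⁺ (true  ∷ w) (false ∷ v) w⊆v = ⊥-elim (w⊆v zero _)
  ∈-subs⁺ (false ∷ w) (true  ∷ v) w⊆v = ∈-++⁺ˡ (∈-map⁺ (false ∷_) (∈-subs⁺ w v (w⊆v ∘ suc)))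
  ∈-subs⁺ (true  ∷ w) (true  ∷ v) w⊆v = ∈-++⁺ʳ (map (false ∷_) (subs v)) (∈-map⁺ (true ∷_) (∈-subs⁺ w v (w⊆v ∘ suc)))

open Subsets

module Permutations where

  open import Data.Bool using (Bool; true; false; T)
  open import Data.Bool.ListAction using (any; all; or; and)
  open import Data.Nat using (ℕ; zero; suc)
  open import Data.Fin using (Fin; zero; suc)
  open import Data.Fin.Permutation using (Permutation′; _⟨$⟩ʳ_; _⟨$⟩ˡ_; inverseˡ; inverseʳ; flip)
  open import Data.List using (List; map; allFin)
  import Data.List as List
  import Data.List.Properties as ListP
  open import Data.List.Membership.Propositional using (_∈_)
  open import Data.List.Membership.Propositional.Properties using (∈-map⁺; ∈-map⁻; ∈-allFin)
  open import Data.List.Membership.Propositional.Properties.WithK using (unique∧set⇒bag)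
  open import Data.List.Relation.Binary.BagAndSetEquality using (∼bag⇒↭)
  open import Data.List.Relation.Binary.Permutation.Propositional using (_↭_; ↭-sym)
  open import Data.List.Relation.Binary.Permutation.Propositional.Properties
    using (↭-length; filter-↭; Any-resp-↭; All-resp-↭)
  open import Data.List.Relation.Unary.Unique.Propositional using (Unique)
  import Data.List.Relation.Unary.Unique.Propositional.Properties as Unique
  import Data.List.Relation.Unary.All.Properties as All
  import Data.List.Relation.Unary.Any.Properties as Any
  open import Data.Vec using (Vec; lookup; tabulate)
  open import Data.Vec.Properties using (lookup∘tabulate; tabulate∘lookup; tabulate-cong)
  open import Data.Product using (_,_)
  open import Function using (_∘_; id; _⇔_; mk⇔)
  open import Relation.Nullary.Decidable using (T?)
  open import Relation.Binary.PropositionalEquality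

  ↭-of-unique-same-elements : {A : Set} {xs ys : List A} → Unique xs → Unique ys →
                              (∀ {z} → z ∈ xs ⇔ z ∈ ys) → xs ↭ ys
  ↭-of-unique-same-elements xs! ys! xs≐ys = ∼bag⇒↭ (unique∧set⇒bag xs! ys! xs≐ys)

  countᵇ-tabulate : {A : Set} {M : ℕ} (p : A → Bool) (g : Fin M → A) →
                    countᵇ p (List.tabulate g) ≡ countT (tabulate (p ∘ g))
  countᵇ-tabulate {M = zero}  p g = refl
  countᵇ-tabulate {M = suc M} p g with p (g zero)
  ... | true  = cong suc (countᵇ-tabulate p (g ∘ suc))
  ... | false = countᵇ-tabulate p (g ∘ suc)

  module _ {A : Set} (p : A → Bool) {xs ys : List A} (xs↭ys : xs ↭ ys) where

    countᵇ-↭ : countᵇ p xs ≡ countᵇ p ys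
    countᵇ-↭ = ↭-length (filter-↭ (T? ∘ p) xs↭ys)

    any-↭ : any p xs ≡ any p ys
    any-↭ = T-injective (move xs↭ys) (move (↭-sym xs↭ys))
      where
      move : ∀ {xs ys} → xs ↭ ys → T (any p xs) → T (any p ys)
      move xs↭ys = Any.any⁺ p ∘ Any-resp-↭ xs↭ys ∘ Any.any⁻ p _

    all-↭ : all p xs ≡ all p ys
    all-↭ = T-injective (move xs↭ys) (move (↭-sym xs↭ys))
      where
      move : ∀ {xs ys} → xs ↭ ys → T (all p xs) → T (all p ys)
      move xs↭ys = All.all⁻ p ∘ All-resp-↭ xs↭ys ∘ All.all⁺ p _

  permute : {A : Set} {n : ℕ} → Permutation′ n → Vec A n → Vec A n
  permute π v = tabulate (λ i → lookup v (π ⟨$⟩ʳ i))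

  module _ {n : ℕ} (π : Permutation′ n) where

    ⟨$⟩ʳ-injective : ∀ {i j} → π ⟨$⟩ʳ i ≡ π ⟨$⟩ʳ j → i ≡ j
    ⟨$⟩ʳ-injective πi≡πj = trans (sym (inverseˡ π)) (trans (cong (π ⟨$⟩ˡ_) πi≡πj) (inverseˡ π))

    allFin-permute-↭ : map (π ⟨$⟩ʳ_) (allFin n) ↭ allFin n
    allFin-permute-↭ =
      ↭-of-unique-same-elements (Unique.map⁺ ⟨$⟩ʳ-injective (Unique.allFin⁺ n)) (Unique.allFin⁺ n)
        (λ {i} → mk⇔ (λ _ → ∈-allFin i) (λ _ → subst (_∈ map (π ⟨$⟩ʳ_) (allFin n)) (inverseʳ π)
                                                      (∈-map⁺ (π ⟨$⟩ʳ_) (∈-allFin (π ⟨$⟩ˡ i)))))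

    any-allFin-permute : (f : Fin n → Bool) → any (f ∘ (π ⟨$⟩ʳ_)) (allFin n) ≡ any f (allFin n)
    any-allFin-permute f = trans (cong or (ListP.map-∘ (allFin n))) (any-↭ f allFin-permute-↭)

    all-allFin-permute : (f : Fin n → Bool) → all (f ∘ (π ⟨$⟩ʳ_)) (allFin n) ≡ all f (allFin n)
    all-allFin-permute f = trans (cong and (ListP.map-∘ (allFin n))) (all-↭ f allFin-permute-↭)

    countT-permute : (v : Vec Bool n) → countT (permute π v) ≡ countT v
    countT-permute v = begin
      countT (permute π v)                          ≡⟨ countᵇ-tabulate (lookup v ∘ (π ⟨$⟩ʳ_)) id ⟨
      countᵇ (lookup v ∘ (π ⟨$⟩ʳ_)) (allFin n)       ≡⟨ countᵇ-map (lookup v) (π ⟨$⟩ʳ_) (allFin n) ⟨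
      countᵇ (lookup v) (map (π ⟨$⟩ʳ_) (allFin n))   ≡⟨ countᵇ-↭ (lookup v) allFin-permute-↭ ⟩
      countᵇ (lookup v) (allFin n)                   ≡⟨ countᵇ-tabulate (lookup v) id ⟩
      countT (tabulate (lookup v))                   ≡⟨ cong countT (tabulate∘lookup v) ⟩
      countT v                                       ∎
      where open ≡-Reasoning

    permute-⊆ᵛ : (w v : Vec Bool n) → w ⊆ᵛ v → permute π w ⊆ᵛ permute π v
    permute-⊆ᵛ w v w⊆v i
      rewrite lookup∘tabulate (lookup w ∘ (π ⟨$⟩ʳ_)) i | lookup∘tabulate (lookup v ∘ (π ⟨$⟩ʳ_)) i = w⊆v (π ⟨$⟩ʳ i)

    flip-permute : {A : Set} (v : Vec A n) → permute (flip π) (permute π v) ≡ v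
    flip-permute v =
      trans (tabulate-cong (λ i → trans (lookup∘tabulate _ (π ⟨$⟩ˡ i)) (cong (lookup v) (inverseʳ π))))
            (tabulate∘lookup v)

  module _ {n : ℕ} (π : Permutation′ n) where

    subs-permute : (v : Vec Bool n) → subs (permute π v) ↭ map (permute π) (subs v)
    subs-permute v =
      ↭-of-unique-same-elements (subs-unique (permute π v)) (Unique.map⁺ permute-injective (subs-unique v))
        (λ {w} → mk⇔ (forth w) (back w))
      where
      permute-injective : ∀ {w w′} → permute π w ≡ permute π w′ → w ≡ w′
      permute-injective {w} {w′} eq =
        trans (sym (flip-permute π w)) (trans (cong (permute (flip π)) eq) (flip-permute π w′))
      forth : ∀ w → w ∈ subs (permute π v) → w ∈ map (permute π) (subs v)
      forth w w∈ = subst (_∈ map (permute π) (subs v)) (flip-permute (flip π) w)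
                         (∈-map⁺ (permute π) (∈-subs⁺ (permute (flip π) w) v w′⊆v))
        where
        w′⊆v : permute (flip π) w ⊆ᵛ v
        w′⊆v = subst (permute (flip π) w ⊆ᵛ_) (flip-permute π v)
                     (permute-⊆ᵛ (flip π) w (permute π v) (∈-subs⁻ w (permute π v) w∈))
      back : ∀ w → w ∈ map (permute π) (subs v) → w ∈ subs (permute π v)
      back w w∈ with ∈-map⁻ (permute π) w∈
      ... | u , u∈ , refl = ∈-subs⁺ (permute π u) (permute π v) (permute-⊆ᵛ π u v (∈-subs⁻ u v u∈))

open Permutations

module EdgeIndices where

  open import Data.Bool using (Bool; _∧_; _∨_; T)
  open import Data.Bool.Properties using (T-∧; T-∨; ∨-zeroʳ)
  open import Data.Nat as ℕ using (ℕ; zero; suc; _<_; _<ᵇ_)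
  import Data.Nat.Properties as ℕ
  open import Data.Fin as Fin using (Fin; toℕ; _≟_)
  import Data.Fin.Properties as Fin
  open import Data.List as List using (List; _∷_; map; allFin; filterᵇ)
  open import Data.List.Membership.Propositional using (_∈_; lose)
  open import Data.List.Membership.Propositional.Properties
    using (∈-allFin; ∈-map⁺; ∈-map⁻; ∈-filter⁺; ∈-filter⁻; ∈-concatMap⁺; ∈-concatMap⁻; ∈-lookup)
  open import Data.List.Relation.Unary.All as All using (All; _∷_)
  import Data.List.Relation.Unary.All.Properties as All
  import Data.List.Relation.Unary.AllPairs as AllPairs
  import Data.List.Relation.Unary.AllPairs.Properties as AllPairs
  open import Data.List.Relation.Unary.Any as Any using (Any)
  import Data.List.Relation.Unary.Any.Properties as Any
  open import Data.List.Relation.Unary.Unique.Propositional using (Unique)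
  import Data.List.Relation.Unary.Unique.Propositional.Properties as Unique
  open import Data.Vec using (lookup)
  open import Data.Product using (∃; _×_; _,_; proj₁; proj₂)
  open import Data.Sum using (_⊎_; inj₁; inj₂)
  open import Data.Empty using (⊥-elim)
  open import Function using (_∘_; Equivalence)
  open import Relation.Nullary using (¬_; yes; does)
  open import Relation.Nullary.Decidable using (T?; dec-true)
  open import Relation.Binary.PropositionalEquality
  open import Relation.Binary.Definitions using (tri<; tri≈; tri>)

  module _ {n : ℕ} where

    Ordered : Fin n × Fin n → Set
    Ordered (a , b) = toℕ a < toℕ b

    private
      row : Fin n → List (Fin n × Fin n)
      row i = map (i ,_) (filterᵇ (λ j → toℕ i <ᵇ toℕ j) (allFin n))

      ∈-row⁻ : ∀ i {p} → p ∈ row i → proj₁ p ≡ i × Ordered p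
      ∈-row⁻ i p∈ with ∈-map⁻ (i ,_) p∈
      ... | j , j∈ , refl =
        refl , ℕ.<ᵇ⇒< (toℕ i) (toℕ j) (proj₂ (∈-filter⁻ (T? ∘ (λ j → toℕ i <ᵇ toℕ j)) {xs = allFin n} j∈))

    ∈-pairs⁺ : ∀ {a b} → toℕ a < toℕ b → (a , b) ∈ pairs n
    ∈-pairs⁺ {a} {b} a<b = ∈-concatMap⁺ row (lose (∈-allFin a)
      (∈-map⁺ (a ,_) (∈-filter⁺ (T? ∘ (λ j → toℕ a <ᵇ toℕ j)) (∈-allFin b) (ℕ.<⇒<ᵇ a<b))))

    ∈-pairs⁻ : ∀ {p} → p ∈ pairs n → Ordered p
    ∈-pairs⁻ p∈ with Any.satisfied (∈-concatMap⁻ row {xs = allFin n} p∈)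
    ... | i , p∈row = proj₂ (∈-row⁻ i p∈row)

    pairs-unique : Unique (pairs n)
    pairs-unique = Unique.concat⁺ (All.map⁺ (All.tabulate (λ {i} _ → row-unique i)))
                                  (AllPairs.map⁺ (AllPairs.map rows-disjoint (Unique.allFin⁺ n)))
      where
      row-unique : ∀ i → Unique (row i)
      row-unique i =
        Unique.map⁺ (λ { refl → refl }) (Unique.filter⁺ (T? ∘ (λ j → toℕ i <ᵇ toℕ j)) (Unique.allFin⁺ n))
      rows-disjoint : ∀ {i j} → i ≢ j → ∀ {p} → ¬ (p ∈ row i × p ∈ row j)
      rows-disjoint i≢j (p∈i , p∈j) = i≢j (trans (sym (proj₁ (∈-row⁻ _ p∈i))) (proj₁ (∈-row⁻ _ p∈j)))

  lookup-injective : {A : Set} {xs : List A} → Unique xs → ∀ i j → List.lookup xs i ≡ List.lookup xs j → i ≡ j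
  lookup-injective {xs = _ ∷ _} _                   Fin.zero    Fin.zero    _  = refl
  lookup-injective {xs = _ ∷ _} (x∉xs AllPairs.∷ _) Fin.zero    (Fin.suc j) eq =
    ⊥-elim (All.lookup x∉xs (∈-lookup j) eq)
  lookup-injective {xs = _ ∷ _} (x∉xs AllPairs.∷ _) (Fin.suc i) Fin.zero    eq =
    ⊥-elim (All.lookup x∉xs (∈-lookup i) (sym eq))
  lookup-injective {xs = _ ∷ _} (_ AllPairs.∷ xs!)  (Fin.suc i) (Fin.suc j) eq =
    cong Fin.suc (lookup-injective xs! i j eq)

  module _ {n : ℕ} where

    endpoints : Fin (N n) → Fin n × Fin n
    endpoints = List.lookup (pairs n)

    endpoints-injective : ∀ {e e′} → endpoints e ≡ endpoints e′ → e ≡ e′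
    endpoints-injective = lookup-injective pairs-unique _ _

    endpoints-ordered : ∀ e → Ordered (endpoints e)
    endpoints-ordered e = ∈-pairs⁻ (∈-lookup e)

    endpoints-distinct : ∀ e → proj₁ (endpoints e) ≢ proj₂ (endpoints e)
    endpoints-distinct e a≡b = ℕ.<-irrefl (cong toℕ a≡b) (endpoints-ordered e)

    Joins : Fin (N n) → Fin n → Fin n → Set
    Joins e u v = endpoints e ≡ (u , v) ⊎ endpoints e ≡ (v , u)

    Joins-sym : ∀ {e u v} → Joins e u v → Joins e v u
    Joins-sym (inj₁ eq) = inj₂ eq
    Joins-sym (inj₂ eq) = inj₁ eq

    Joins-unique : ∀ {e e′ u v} → Joins e u v → Joins e′ u v → e ≡ e′
    Joins-unique (inj₁ eq) (inj₁ eq′) = endpoints-injective (trans eq (sym eq′))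
    Joins-unique (inj₂ eq) (inj₂ eq′) = endpoints-injective (trans eq (sym eq′))
    Joins-unique {e} {e′} (inj₁ eq) (inj₂ eq′) =
      ⊥-elim (ℕ.<-asym (subst Ordered eq (endpoints-ordered e)) (subst Ordered eq′ (endpoints-ordered e′)))
    Joins-unique {e} {e′} (inj₂ eq) (inj₁ eq′) =
      ⊥-elim (ℕ.<-asym (subst Ordered eq (endpoints-ordered e)) (subst Ordered eq′ (endpoints-ordered e′)))

    Joins-pair : ∀ {e a b c d} → Joins e a b → Joins e c d → (a ≡ c × b ≡ d) ⊎ (a ≡ d × b ≡ c)
    Joins-pair (inj₁ p) (inj₁ q) = inj₁ (cong proj₁ (trans (sym p) q) , cong proj₂ (trans (sym p) q))
    Joins-pair (inj₁ p) (inj₂ q) = inj₂ (cong proj₁ (trans (sym p) q) , cong proj₂ (trans (sym p) q))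
    Joins-pair (inj₂ p) (inj₁ q) = inj₂ (cong proj₂ (trans (sym p) q) , cong proj₁ (trans (sym p) q))
    Joins-pair (inj₂ p) (inj₂ q) = inj₁ (cong proj₂ (trans (sym p) q) , cong proj₁ (trans (sym p) q))

    edgeBetween : ∀ {u v} → u ≢ v → ∃ λ e → Joins e u v
    edgeBetween {u} {v} u≢v with ℕ.<-cmp (toℕ u) (toℕ v)
    ... | tri< u<v _ _ = Any.index (∈-pairs⁺ u<v) , inj₁ (sym (Any.lookup-index (∈-pairs⁺ u<v)))
    ... | tri≈ _ u≡v _ = ⊥-elim (u≢v (Fin.toℕ-injective u≡v))
    ... | tri> _ _ v<u = Any.index (∈-pairs⁺ v<u) , inj₂ (sym (Any.lookup-index (∈-pairs⁺ v<u)))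

    private
      -- The pair test inside Defs.adj, so that adj w u v is definitionally
      -- any (λ e → lookup (edgeVec w) e ∧ joinsᵇ u v (endpoints e)) (allFin (N n)).
      joinsᵇ : Fin n → Fin n → Fin n × Fin n → Bool
      joinsᵇ u v (a , b) = (does (a ≟ u) ∧ does (b ≟ v)) ∨ (does (a ≟ v) ∧ does (b ≟ u))

      ≟-sound : ∀ {x y : Fin n} → T (does (x ≟ y)) → x ≡ y
      ≟-sound {x} {y} t with x ≟ y
      ... | yes x≡y = x≡y

      joinsᵇ-sound : ∀ {u v} p → T (joinsᵇ u v p) → p ≡ (u , v) ⊎ p ≡ (v , u)
      joinsᵇ-sound {u} {v} (a , b) t with Equivalence.to (T-∨ {does (a ≟ u) ∧ does (b ≟ v)}) t
      ... | inj₁ t₁ = let ta , tb = Equivalence.to (T-∧ {does (a ≟ u)}) t₁ in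
                      inj₁ (cong₂ _,_ (≟-sound ta) (≟-sound tb))
      ... | inj₂ t₂ = let ta , tb = Equivalence.to (T-∧ {does (a ≟ v)}) t₂ in
                      inj₂ (cong₂ _,_ (≟-sound ta) (≟-sound tb))

      joinsᵇ-complete : ∀ {u v} p → p ≡ (u , v) ⊎ p ≡ (v , u) → T (joinsᵇ u v p)
      joinsᵇ-complete {u} {v} _ (inj₁ refl) rewrite dec-true (u ≟ u) refl | dec-true (v ≟ v) refl = _
      joinsᵇ-complete {u} {v} _ (inj₂ refl) rewrite dec-true (u ≟ u) refl | dec-true (v ≟ v) refl
        | ∨-zeroʳ (does (v ≟ u) ∧ does (u ≟ v)) = _

    T-adj⁻ : ∀ (w : Graph n) {u v} → T (adj w u v) → ∃ λ e → T (lookup (edgeVec w) e) × Joins e u v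
    T-adj⁻ w {u} {v} t
      with Any.satisfied (Any.any⁻ (λ e → lookup (edgeVec w) e ∧ joinsᵇ u v (endpoints e)) (allFin (N n)) t)
    ... | e , te = let t₁ , t₂ = Equivalence.to T-∧ te in e , t₁ , joinsᵇ-sound (endpoints e) t₂

    T-adj⁺ : ∀ (w : Graph n) {u v e} → T (lookup (edgeVec w) e) → Joins e u v → T (adj w u v)
    T-adj⁺ w {u} {v} {e} t j = Any.any⁺ (λ e → lookup (edgeVec w) e ∧ joinsᵇ u v (endpoints e))
                                        (lose (∈-allFin e) (Equivalence.from T-∧ (t , joinsᵇ-complete (endpoints e) j)))

    adj-joins : ∀ (w : Graph n) {e u v} → Joins e u v → adj w u v ≡ lookup (edgeVec w) e
    adj-joins w j = T-injective edge⇒ (λ t → T-adj⁺ w t j)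
      where
      edge⇒ : T (adj w _ _) → T (lookup (edgeVec w) _)
      edge⇒ t with T-adj⁻ w t
      ... | e′ , t′ , j′ = subst (T ∘ lookup (edgeVec w)) (Joins-unique j′ j) t′

open EdgeIndices

module Relabelling where

  open import Data.Bool using (Bool; _∧_; _∨_; not; T)
  open import Data.Bool.ListAction using (any; all; or; and)
  open import Data.Nat using (ℕ; zero; suc; _∸_; _≡ᵇ_)
  open import Data.Fin using (Fin; _≟_)
  open import Data.Fin.Permutation using (Permutation′; _⟨$⟩ʳ_; inverseˡ; inverseʳ; flip; permutation)
  open import Data.List using (map; allFin)
  import Data.List.Properties as ListP
  open import Data.Vec using (lookup; tabulate)
  open import Data.Vec.Properties using (lookup∘tabulate; tabulate∘lookup; tabulate-cong)
  open import Data.Product using (_,_; proj₁; proj₂)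
  open import Data.Sum using (inj₁; inj₂)
  open import Data.Empty using (⊥-elim)
  open import Function using (_∘_)
  open import Relation.Nullary using (yes; no)
  open import Relation.Binary.PropositionalEquality

  module _ {n : ℕ} (σ : Permutation′ n) where

    relabelEdge : Fin (N n) → Fin (N n)
    relabelEdge e = proj₁ (edgeBetween (endpoints-distinct e ∘ ⟨$⟩ʳ-injective σ))

    relabelEdge-joins : ∀ {e u v} → Joins e u v → Joins (relabelEdge e) (σ ⟨$⟩ʳ u) (σ ⟨$⟩ʳ v)
    relabelEdge-joins {e} (inj₁ eq) =
      subst₂ (Joins (relabelEdge e)) (cong (λ p → σ ⟨$⟩ʳ proj₁ p) eq) (cong (λ p → σ ⟨$⟩ʳ proj₂ p) eq)
             (proj₂ (edgeBetween (endpoints-distinct e ∘ ⟨$⟩ʳ-injective σ)))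
    relabelEdge-joins {e} (inj₂ eq) = Joins-sym (relabelEdge-joins {e} (inj₁ eq))

  relabelEdge-cancel : ∀ {n} (σ τ : Permutation′ n) → (∀ {i} → τ ⟨$⟩ʳ (σ ⟨$⟩ʳ i) ≡ i) →
                       ∀ e → relabelEdge τ (relabelEdge σ e) ≡ e
  relabelEdge-cancel σ τ τσ≡id e =
    Joins-unique (subst₂ (Joins _) τσ≡id τσ≡id (relabelEdge-joins τ (relabelEdge-joins σ (inj₁ refl)))) (inj₁ refl)

  edgePermutation : ∀ {n} → Permutation′ n → Permutation′ (N n)
  edgePermutation σ = permutation (relabelEdge σ) (relabelEdge (flip σ))
                                  (relabelEdge-cancel (flip σ) σ (inverseʳ σ))
                                  (relabelEdge-cancel σ (flip σ) (inverseˡ σ))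

  relabel : ∀ {n} → Permutation′ n → Graph n → Graph n
  relabel σ X = mkGraph (permute (edgePermutation σ) (edgeVec X))

  module _ {n : ℕ} (σ : Permutation′ n) where

    lookup-relabel : ∀ (X : Graph n) e → lookup (edgeVec (relabel σ X)) e ≡ lookup (edgeVec X) (relabelEdge σ e)
    lookup-relabel X e = lookup∘tabulate _ e

    adj-relabel : ∀ (X : Graph n) u v → adj (relabel σ X) u v ≡ adj X (σ ⟨$⟩ʳ u) (σ ⟨$⟩ʳ v)
    adj-relabel X u v = T-injective forth back
      where
      forth : T (adj (relabel σ X) u v) → T (adj X (σ ⟨$⟩ʳ u) (σ ⟨$⟩ʳ v))
      forth t with T-adj⁻ (relabel σ X) t
      ... | e , te , j = T-adj⁺ X (subst T (lookup-relabel X e) te) (relabelEdge-joins σ j)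
      back : T (adj X (σ ⟨$⟩ʳ u) (σ ⟨$⟩ʳ v)) → T (adj (relabel σ X) u v)
      back t with T-adj⁻ X t
      ... | e , te , j =
        T-adj⁺ (relabel σ X) (subst T (sym (trans (lookup-relabel X e⁻) (cong (lookup (edgeVec X)) cancel))) te)
                             (subst₂ (Joins e⁻) (inverseˡ σ) (inverseˡ σ) (relabelEdge-joins (flip σ) j))
        where
        e⁻ : Fin (N n)
        e⁻ = relabelEdge (flip σ) e
        cancel : relabelEdge σ e⁻ ≡ e
        cancel = relabelEdge-cancel (flip σ) σ (inverseʳ σ) e

    reach-relabel : ∀ (X : Graph n) u k v → reach (relabel σ X) u k v ≡ reach X (σ ⟨$⟩ʳ u) k (σ ⟨$⟩ʳ v)
    reach-relabel X u zero v with u ≟ v | σ ⟨$⟩ʳ u ≟ σ ⟨$⟩ʳ v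
    ... | yes _    | yes _      = refl
    ... | no _     | no _       = refl
    ... | yes refl | no σu≢σu   = ⊥-elim (σu≢σu refl)
    ... | no u≢v   | yes σu≡σv  = ⊥-elim (u≢v (⟨$⟩ʳ-injective σ σu≡σv))
    reach-relabel X u (suc k) v = cong₂ _∨_ (reach-relabel X u k v) (begin
      any (λ w → reach (relabel σ X) u k w ∧ adj (relabel σ X) w v) (allFin n)
        ≡⟨ cong or (ListP.map-cong (λ w → cong₂ _∧_ (reach-relabel X u k w) (adj-relabel X w v)) (allFin n)) ⟩
      any (λ w → reach X (σ ⟨$⟩ʳ u) k (σ ⟨$⟩ʳ w) ∧ adj X (σ ⟨$⟩ʳ w) (σ ⟨$⟩ʳ v)) (allFin n)
        ≡⟨ any-allFin-permute σ (λ w → reach X (σ ⟨$⟩ʳ u) k w ∧ adj X w (σ ⟨$⟩ʳ v)) ⟩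
      any (λ w → reach X (σ ⟨$⟩ʳ u) k w ∧ adj X w (σ ⟨$⟩ʳ v)) (allFin n) ∎)
      where open ≡-Reasoning

    connected-relabel : ∀ (X : Graph n) → connected (relabel σ X) ≡ connected X
    connected-relabel X = begin
      all (λ u → all (λ v → reach (relabel σ X) u n v) (allFin n)) (allFin n)
        ≡⟨ cong and (ListP.map-cong (λ u → cong and (ListP.map-cong (reach-relabel X u n) (allFin n))) (allFin n)) ⟩
      all (λ u → all (λ v → reach X (σ ⟨$⟩ʳ u) n (σ ⟨$⟩ʳ v)) (allFin n)) (allFin n)
        ≡⟨ cong and (ListP.map-cong (λ u → all-allFin-permute σ (reach X (σ ⟨$⟩ʳ u) n)) (allFin n)) ⟩
      all (λ u → all (λ v → reach X (σ ⟨$⟩ʳ u) n v) (allFin n)) (allFin n)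
        ≡⟨ all-allFin-permute σ (λ u → all (λ v → reach X u n v) (allFin n)) ⟩
      all (λ u → all (λ v → reach X u n v) (allFin n)) (allFin n) ∎
      where open ≡-Reasoning

    edgeCount-relabel : ∀ (X : Graph n) → edgeCount (relabel σ X) ≡ edgeCount X
    edgeCount-relabel X = countT-permute (edgePermutation σ) (edgeVec X)

    μ-relabel : ∀ k (X : Graph n) → μ k (relabel σ X) ≡ μ k X
    μ-relabel k X = begin
      countᵇ (cut (relabel σ X)) (map mkGraph (subs (permute π (edgeVec X))))
        ≡⟨ countᵇ-map (cut (relabel σ X)) mkGraph (subs (permute π (edgeVec X))) ⟩
      countᵇ (cut (relabel σ X) ∘ mkGraph) (subs (permute π (edgeVec X)))
        ≡⟨ countᵇ-↭ (cut (relabel σ X) ∘ mkGraph) (subs-permute π (edgeVec X)) ⟩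
      countᵇ (cut (relabel σ X) ∘ mkGraph) (map (permute π) (subs (edgeVec X)))
        ≡⟨ countᵇ-map (cut (relabel σ X) ∘ mkGraph) (permute π) (subs (edgeVec X)) ⟩
      countᵇ (cut (relabel σ X) ∘ relabel σ ∘ mkGraph) (subs (edgeVec X))
        ≡⟨ countᵇ-cong (λ w → cong₂ (λ c e → not c ∧ (e ≡ᵇ k)) (connected-relabel (mkGraph w))
                                     (cong₂ _∸_ (edgeCount-relabel X) (edgeCount-relabel (mkGraph w))))
                       (subs (edgeVec X)) ⟩
      countᵇ (cut X ∘ mkGraph) (subs (edgeVec X))
        ≡⟨ countᵇ-map (cut X) mkGraph (subs (edgeVec X)) ⟨
      μ k X ∎
      where
      open ≡-Reasoning
      π : Permutation′ (N n)
      π = edgePermutation σ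
      cut : Graph n → Graph n → Bool
      cut Y S = not (connected S) ∧ ((edgeCount Y ∸ edgeCount S) ≡ᵇ k)

  Iso⇒≡relabel : ∀ {n} {G H : Graph n} (G≅H : Iso G H) → G ≡ relabel (proj₁ G≅H) H
  Iso⇒≡relabel {G = G} {H} (σ , adj-G≡adj-H) = cong mkGraph (begin
    edgeVec G                                   ≡⟨ tabulate∘lookup (edgeVec G) ⟨
    tabulate (lookup (edgeVec G))               ≡⟨ tabulate-cong same-edges ⟩
    tabulate (lookup (edgeVec (relabel σ H)))   ≡⟨ tabulate∘lookup _ ⟩
    edgeVec (relabel σ H)                       ∎)
    where
    open ≡-Reasoning
    same-edges : ∀ e → lookup (edgeVec G) e ≡ lookup (edgeVec (relabel σ H)) e
    same-edges e = begin
      lookup (edgeVec G) e                 ≡⟨ adj-joins G (inj₁ refl) ⟨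
      adj G a b                            ≡⟨ adj-G≡adj-H a b ⟩
      adj H (σ ⟨$⟩ʳ a) (σ ⟨$⟩ʳ b)          ≡⟨ adj-relabel σ H a b ⟨
      adj (relabel σ H) a b                ≡⟨ adj-joins (relabel σ H) (inj₁ refl) ⟩
      lookup (edgeVec (relabel σ H)) e     ∎
      where
      a b : Fin _
      a = proj₁ (endpoints e)
      b = proj₂ (endpoints e)

  μ-iso : ∀ {n} k {G H : Graph n} → Iso G H → μ k G ≡ μ k H
  μ-iso k {G} {H} G≅H = trans (cong (μ k) (Iso⇒≡relabel {G = G} {H} G≅H)) (μ-relabel (proj₁ G≅H) k H)

open Relabelling

module ConnectedGraphs where

  open import Data.Bool using (Bool; true; false; _∧_; T)
  open import Data.Bool.Properties using (T-∧; T-∨)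
  open import Data.Bool.ListAction using (any; all)
  open import Data.Nat
  open import Data.Nat.Properties
  open import Data.Fin as Fin using (Fin; zero; suc)
  import Data.Fin.Properties as Fin
  open import Data.List using (allFin)
  open import Data.List.Membership.Propositional.Properties using (∈-allFin)
  import Data.List.Relation.Unary.All as All
  import Data.List.Relation.Unary.All.Properties as All
  import Data.List.Relation.Unary.Any as Any
  import Data.List.Relation.Unary.Any.Properties as Any
  open import Data.Vec using (Vec; _∷_; lookup)
  open import Data.Product using (∃; _×_; _,_; proj₁; proj₂)
  open import Data.Sum using ([_,_]′)
  open import Data.Empty using (⊥-elim)
  open import Function using (_∘_; Equivalence)
  open import Relation.Nullary using (¬_; yes; no; contradiction)
  open import Relation.Binary.PropositionalEquality

  rank : ∀ {M} (v : Vec Bool M) e → T (lookup v e) → Fin (countT v)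
  rank (true  ∷ v) zero    _ = zero
  rank (true  ∷ v) (suc e) t = suc (rank v e t)
  rank (false ∷ v) (suc e) t = rank v e t

  rank-injective : ∀ {M} (v : Vec Bool M) e e′ t t′ → rank v e t ≡ rank v e′ t′ → e ≡ e′
  rank-injective (true  ∷ v) zero    zero     _ _ _  = refl
  rank-injective (true  ∷ v) (suc e) (suc e′) t t′ eq = cong suc (rank-injective v e e′ t t′ (Fin.suc-injective eq))
  rank-injective (false ∷ v) (suc e) (suc e′) t t′ eq = cong suc (rank-injective v e e′ t t′ eq)

  injective⇒≤countT : ∀ {a M} (v : Vec Bool M) (f : Fin a → Fin M) → (∀ {i j} → f i ≡ f j → i ≡ j) →
                      (∀ i → T (lookup v (f i))) → a ≤ countT v
  injective⇒≤countT v f f-injective t =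
    Fin.injective⇒≤ {f = λ i → rank v (f i) (t i)} (f-injective ∘ rank-injective v _ _ _ _)

  Least : (ℕ → Bool) → ℕ → Set
  Least f k = T (f k) × (∀ j → j < k → ¬ T (f j))

  least : (f : ℕ → Bool) → ∀ K → T (f K) → ∃ (Least f)
  least f K t with f 0 in f0
  ... | true  = 0 , subst T (sym f0) _ , (λ _ ())
  least f zero    t | false = ⊥-elim (subst T f0 t)
  least f (suc K) t | false with least (f ∘ suc) K t
  ... | k , tk , below = suc k , tk , λ { zero _ → subst T f0 ; (suc j) (s≤s j<k) → below j j<k }

  Least-≤ : ∀ {f k j} → Least f k → T (f j) → k ≤ j
  Least-≤ {k = k} {j} (_ , below) tj with k ≤? j
  ... | yes k≤j = k≤j
  ... | no  k≰j = contradiction tj (below j (≰⇒> k≰j))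

  T-all-allFin : ∀ {m} (f : Fin m → Bool) → T (all f (allFin m)) → ∀ i → T (f i)
  T-all-allFin {m} f t i = All.lookup (All.all⁺ f (allFin m) t) (∈-allFin i)

  -- Every vertex other than the root 0 gets the edge to a neighbour one BFS level closer to the root.
  -- Two vertices sharing that edge would each lie strictly below the other, so the edges are distinct.
  module BreadthFirst {n : ℕ} (X : Graph (suc n)) (X-connected : T (connected X)) where

    levelOf : ∀ v → ∃ (Least (λ k → reach X zero k v))
    levelOf v = least (λ k → reach X zero k v) (suc n) (T-all-allFin _ reaches-from-root v)
      where
      reaches-from-root : T (all (λ v → reach X zero (suc n) v) (allFin (suc n)))
      reaches-from-root = T-all-allFin (λ u → all (λ v → reach X u (suc n) v) (allFin (suc n))) X-connected zero

    level : Fin (suc n) → ℕ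
    level v = proj₁ (levelOf v)

    record Parent (v : Fin (suc n)) : Set where
      field
        k       : ℕ
        level≡  : level v ≡ suc k
        x       : Fin (suc n)
        reach-x : T (reach X zero k x)
        edge    : Fin (N (suc n))
        edge∈X  : T (lookup (edgeVec X) edge)
        joins   : Joins edge x v

    parent : ∀ i → Parent (suc i)
    parent i = parentAt (level (suc i)) (proj₂ (levelOf (suc i))) refl
      where
      parentAt : ∀ k → Least (λ k → reach X zero k (suc i)) k → level (suc i) ≡ k → Parent (suc i)
      parentAt zero    (() , _)
      parentAt (suc k) (t , below) level≡ =
        [ (λ reached → contradiction reached (below k ≤-refl)) , viaNeighbour ]′
          (Equivalence.to (T-∨ {reach X zero k (suc i)}) t)
        where
        viaNeighbour : T (any (λ w → reach X zero k w ∧ adj X w (suc i)) (allFin (suc n))) → Parent (suc i)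
        viaNeighbour t′ =
          let x , tx          = Any.satisfied (Any.any⁻ (λ w → reach X zero k w ∧ adj X w (suc i)) (allFin (suc n)) t′)
              reach-x , adj-x = Equivalence.to (T-∧ {reach X zero k x}) tx
              e , e∈X , joins = T-adj⁻ X adj-x
          in record { k = k ; level≡ = level≡ ; x = x ; reach-x = reach-x ; edge = e ; edge∈X = e∈X ; joins = joins }

    level-parent : ∀ {v w} (P : Parent v) → Parent.x P ≡ w → level w < level v
    level-parent {v} {w} P refl =
      subst (level w <_) (sym (Parent.level≡ P)) (s≤s (Least-≤ (proj₂ (levelOf w)) (Parent.reach-x P)))

    parent-injective : ∀ {i j} → Parent.edge (parent i) ≡ Parent.edge (parent j) → i ≡ j
    parent-injective {i} {j} same-edge =
      [ (λ (_ , i≡j) → Fin.suc-injective i≡j)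
      , (λ (xᵢ≡j , i≡xⱼ) → ⊥-elim (<-asym (level-parent (parent i) xᵢ≡j) (level-parent (parent j) (sym i≡xⱼ))))
      ]′ (Joins-pair (Parent.joins (parent i))
                     (subst (λ e → Joins e _ (suc j)) (sym same-edge) (Parent.joins (parent j))))

  connected⇒n∸1≤edgeCount : ∀ {n} (X : Graph n) → T (connected X) → n ∸ 1 ≤ edgeCount X
  connected⇒n∸1≤edgeCount {zero}  X _           = z≤n
  connected⇒n∸1≤edgeCount {suc n} X X-connected =
    injective⇒≤countT (edgeVec X) (Parent.edge ∘ parent) parent-injective (Parent.edge∈X ∘ parent)
    where open BreadthFirst X X-connected

open ConnectedGraphs

module Reliability where

  open import Data.Bool using (true; false; _∧_; if_then_else_)
  open import Data.Nat as ℕ using (ℕ; zero; suc; _∸_; _≡ᵇ_; _≤_)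
  import Data.Nat.Properties as ℕ
  open import Data.Nat.ListAction using (sum)
  open import Data.Rational as ℚ using (ℚ; 0ℚ; 1ℚ; _+_; _*_; _-_; 1/_; NonZero)
  import Data.Rational.Properties as ℚ
  open import Algebra.Bundles using (CommutativeRing; CommutativeSemiring; CommutativeMonoid)
  open CommutativeRing ℚ.+-*-commutativeRing using (commutativeSemiring)
  open CommutativeSemiring commutativeSemiring using (semiring)
  open import Algebra.Properties.Semiring.Mult semiring using (×-homo-+; ×1-homo-*) renaming (_×_ to _×ℚ_)
  open import Algebra.Properties.CommutativeSemiring.Exp commutativeSemiring using (_^_; ^-homo-*; ^-distrib-*)
  open import Algebra.Properties.AbelianGroup ℚ.+-0-abelianGroup using (xyx⁻¹≈y)
  open import Algebra.Properties.CommutativeSemigroup (CommutativeMonoid.commutativeSemigroup ℚ.*-1-commutativeMonoid)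
    using () renaming (interchange to *-interchange)
  open import Data.List using (List; []; _∷_; map; foldr)
  open import Data.List.Relation.Unary.All as All using (All; []; _∷_)
  import Data.List.Relation.Unary.All.Properties as All
  open import Relation.Nullary using (yes; no)
  open import Data.Empty using (⊥-elim)
  open import Relation.Binary.PropositionalEquality

  toℚ : ℕ → ℚ
  toℚ n = n ×ℚ 1ℚ

  ^ℚ≡^ : ∀ x k → x ^ℚ k ≡ x ^ k
  ^ℚ≡^ x zero    = refl
  ^ℚ≡^ x (suc k) = cong (x *_) (^ℚ≡^ x k)

  toℚ-^ : ∀ a k → toℚ (a ℕ.^ k) ≡ toℚ a ^ k
  toℚ-^ a zero    = ℚ.+-identityʳ 1ℚ
  toℚ-^ a (suc k) = trans (×1-homo-* a (a ℕ.^ k)) (cong (toℚ a *_) (toℚ-^ a k))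

  toℚ-nonNeg : ∀ a → 0ℚ ℚ.≤ toℚ a
  toℚ-nonNeg zero    = ℚ.≤-refl
  toℚ-nonNeg (suc a) = ℚ.+-mono-≤ (ℚ.<⇒≤ (ℚ.positive⁻¹ 1ℚ)) (toℚ-nonNeg a)

  toℚ-pos : ∀ a → 0ℚ ℚ.< toℚ (suc a)
  toℚ-pos a = ℚ.+-mono-<-≤ (ℚ.positive⁻¹ 1ℚ) (toℚ-nonNeg a)

  toℚ-cancel-≤ : ∀ {a b} → toℚ a ℚ.≤ toℚ b → a ≤ b
  toℚ-cancel-≤ {a} {b} toℚa≤toℚb with a ℕ.≤? b
  ... | yes a≤b = a≤b
  ... | no  a≰b = ⊥-elim (ℚ.<-irrefl refl (ℚ.≤-<-trans toℚa≤toℚb (subst (toℚ b ℚ.<_) b+d≡a b<b+d)))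
    where
    d : ℕ
    d = a ∸ suc b
    b+d≡a : toℚ b + toℚ (suc d) ≡ toℚ a
    b+d≡a = trans (sym (×-homo-+ 1ℚ b (suc d)))
                  (cong toℚ (trans (ℕ.+-comm b (suc d)) (trans (sym (ℕ.+-suc d b)) (ℕ.m∸n+n≡m (ℕ.≰⇒> a≰b)))))
    b<b+d : toℚ b ℚ.< toℚ b + toℚ (suc d)
    b<b+d = subst (ℚ._< toℚ b + toℚ (suc d)) (ℚ.+-identityʳ (toℚ b))
                  (ℚ.+-mono-≤-< (ℚ.≤-refl {toℚ b}) (toℚ-pos d))

  -- The k-edge sets F ⊆ E(X) with X - F connected, encoded by S = X - F as in μ;
  -- in these terms R X ρ = Σ_k nonCuts k X ρ^k (1 - ρ)^(m - k).
  nonCuts : {n : ℕ} → ℕ → Graph n → ℕ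
  nonCuts k X = countᵇ (λ S → connected S ∧ ((edgeCount X ∸ edgeCount S) ≡ᵇ k)) (subgraphs X)

  foldr-+-scaled : {A : Set} (t : A → ℚ) (f : A → ℕ) (K : ℚ) {xs : List A} →
                   All (λ x → t x ≡ toℚ (f x) * K) xs → foldr _+_ 0ℚ (map t xs) ≡ toℚ (sum (map f xs)) * K
  foldr-+-scaled t f K [] = sym (ℚ.*-zeroˡ K)
  foldr-+-scaled t f K {x ∷ xs} (tx≡ ∷ t≡) = begin
    t x + foldr _+_ 0ℚ (map t xs)            ≡⟨ cong₂ _+_ tx≡ (foldr-+-scaled t f K t≡) ⟩
    toℚ (f x) * K + toℚ (sum (map f xs)) * K ≡⟨ ℚ.*-distribʳ-+ K (toℚ (f x)) _ ⟨
    (toℚ (f x) + toℚ (sum (map f xs))) * K   ≡⟨ cong (_* K) (×-homo-+ 1ℚ (f x) _) ⟨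
    toℚ (sum (map f (x ∷ xs))) * K           ∎
    where open ≡-Reasoning

  module AtRatio (a b : ℕ) {s : ℕ} (a+b≡1+s : a ℕ.+ b ≡ suc s) where

    instance
      1+s≢0 : NonZero (toℚ (suc s))
      1+s≢0 = ℚ.pos⇒nonZero (toℚ (suc s)) {{ℚ.positive (toℚ-pos s)}}

    c : ℚ
    c = 1/ toℚ (suc s)

    c-pos : 0ℚ ℚ.< c
    c-pos = ℚ.positive⁻¹ c {{ℚ.1/pos⇒pos (toℚ (suc s)) {{ℚ.positive (toℚ-pos s)}}}}

    ρ : ℚ
    ρ = toℚ a * c

    ρ+ρ̄≡1 : toℚ a * c + toℚ b * c ≡ 1ℚ
    ρ+ρ̄≡1 = begin
      toℚ a * c + toℚ b * c   ≡⟨ ℚ.*-distribʳ-+ c (toℚ a) (toℚ b) ⟨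
      (toℚ a + toℚ b) * c     ≡⟨ cong (_* c) (trans (sym (×-homo-+ 1ℚ a b)) (cong toℚ a+b≡1+s)) ⟩
      toℚ (suc s) * c         ≡⟨ ℚ.*-inverseʳ (toℚ (suc s)) ⟩
      1ℚ                      ∎
      where open ≡-Reasoning

    1-ρ≡ : 1ℚ - ρ ≡ toℚ b * c
    1-ρ≡ = trans (cong (_- ρ) (sym ρ+ρ̄≡1)) (xyx⁻¹≈y ρ (toℚ b * c))

    toℚ*c-nonNeg : ∀ x → 0ℚ ℚ.≤ toℚ x * c
    toℚ*c-nonNeg x =
      subst (ℚ._≤ toℚ x * c) (ℚ.*-zeroˡ c) (ℚ.*-monoʳ-≤-nonNeg c {{ℚ.nonNegative (ℚ.<⇒≤ c-pos)}} (toℚ-nonNeg x))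

    ρ≤1 : ρ ℚ.≤ 1ℚ
    ρ≤1 = subst₂ ℚ._≤_ (ℚ.+-identityʳ ρ) ρ+ρ̄≡1 (ℚ.+-monoʳ-≤ ρ (toℚ*c-nonNeg b))

    survival-weight : ∀ m {t} → t ≤ m →
                      ρ ^ℚ (m ∸ t) * (1ℚ - ρ) ^ℚ t ≡ toℚ (a ℕ.^ (m ∸ t) ℕ.* b ℕ.^ t) * c ^ℚ m
    survival-weight m {t} t≤m = begin
      ρ ^ℚ (m ∸ t) * (1ℚ - ρ) ^ℚ t
        ≡⟨ cong₂ _*_ (^ℚ≡^ ρ (m ∸ t)) (trans (cong (_^ℚ t) 1-ρ≡) (^ℚ≡^ _ t)) ⟩
      (toℚ a * c) ^ (m ∸ t) * (toℚ b * c) ^ t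
        ≡⟨ cong₂ _*_ (^-distrib-* (toℚ a) c (m ∸ t)) (^-distrib-* (toℚ b) c t) ⟩
      (toℚ a ^ (m ∸ t) * c ^ (m ∸ t)) * (toℚ b ^ t * c ^ t)
        ≡⟨ *-interchange (toℚ a ^ (m ∸ t)) (c ^ (m ∸ t)) (toℚ b ^ t) (c ^ t) ⟩
      (toℚ a ^ (m ∸ t) * toℚ b ^ t) * (c ^ (m ∸ t) * c ^ t)
        ≡⟨ cong₂ _*_ (cong₂ _*_ (toℚ-^ a (m ∸ t)) (toℚ-^ b t)) (^-homo-* c (m ∸ t) t) ⟨
      (toℚ (a ℕ.^ (m ∸ t)) * toℚ (b ℕ.^ t)) * c ^ (m ∸ t ℕ.+ t)
        ≡⟨ cong₂ _*_ (×1-homo-* (a ℕ.^ (m ∸ t)) (b ℕ.^ t)) (cong (c ^_) (sym (ℕ.m∸n+n≡m t≤m))) ⟨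
      toℚ (a ℕ.^ (m ∸ t) ℕ.* b ℕ.^ t) * c ^ m
        ≡⟨ cong (toℚ (a ℕ.^ (m ∸ t) ℕ.* b ℕ.^ t) *_) (^ℚ≡^ c m) ⟨
      toℚ (a ℕ.^ (m ∸ t) ℕ.* b ℕ.^ t) * c ^ℚ m ∎
      where open ≡-Reasoning

    reliability-at-ρ : ∀ {n} (X : Graph n) →
      R X ρ ≡ toℚ (∑≤ (edgeCount X) (λ k → nonCuts k X ℕ.* (a ℕ.^ k ℕ.* b ℕ.^ (edgeCount X ∸ k)))) * c ^ℚ edgeCount X
    reliability-at-ρ {n} X =
      trans (foldr-+-scaled term weight (c ^ℚ e) (All.map term≡ edgeCounts≤e))
            (cong (λ z → toℚ z * c ^ℚ e) (∑-groupBy connected removed g removed≤e))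
      where
      e : ℕ
      e = edgeCount X
      g : ℕ → ℕ
      g k = a ℕ.^ k ℕ.* b ℕ.^ (e ∸ k)
      removed : Graph n → ℕ
      removed S = e ∸ edgeCount S
      term : Graph n → ℚ
      term S = if connected S then ρ ^ℚ (e ∸ edgeCount S) * (1ℚ - ρ) ^ℚ edgeCount S else 0ℚ
      weight : Graph n → ℕ
      weight S = if connected S then g (removed S) else 0
      edgeCounts≤e : All (λ S → edgeCount S ≤ e) (subgraphs X)
      edgeCounts≤e = All.map⁺ (subs-countT≤ (edgeVec X))
      removed≤e : All (λ S → removed S ≤ e) (subgraphs X)
      removed≤e = All.map (λ {S} _ → ℕ.m∸n≤m e (edgeCount S)) edgeCounts≤e
      term≡ : ∀ {S} → edgeCount S ≤ e → term S ≡ toℚ (weight S) * c ^ℚ e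
      term≡ {S} S≤e with connected S
      ... | true  = trans (survival-weight e S≤e)
                          (cong (λ t → toℚ (a ℕ.^ (e ∸ edgeCount S) ℕ.* b ℕ.^ t) * c ^ℚ e) (sym (ℕ.m∸[m∸n]≡n S≤e)))
      ... | false = sym (ℚ.*-zeroˡ (c ^ℚ e))

    cancel-c^ : ∀ {A B} m → toℚ A * c ^ℚ m ℚ.≤ toℚ B * c ^ℚ m → A ≤ B
    cancel-c^ m le = toℚ-cancel-≤ (ℚ.*-cancelʳ-≤-pos (c ^ℚ m) {{ℚ.positive (^ℚ-pos c-pos m)}} le)
      where
      ^ℚ-pos : ∀ {x} → 0ℚ ℚ.< x → ∀ k → 0ℚ ℚ.< x ^ℚ k
      ^ℚ-pos x>0 zero    = ℚ.positive⁻¹ 1ℚ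
      ^ℚ-pos {x} x>0 (suc k) =
        ℚ.positive⁻¹ _ {{ℚ.pos*pos⇒pos x {{ℚ.positive x>0}} (x ^ℚ k) {{ℚ.positive (^ℚ-pos x>0 k)}}}}

  module _ {n m : ℕ} {H U : Graph n} (H-edges : edgeCount H ≡ m) (U-edges : edgeCount U ≡ m)
           (H≤U : (ρ : ℚ) → 0ℚ ℚ.≤ ρ → ρ ℚ.≤ 1ℚ → R H ρ ℚ.≤ R U ρ) where

    weighted-nonCuts-≤ : ∀ a b {s} → a ℕ.+ b ≡ suc s →
                         ∑≤ m (λ k → nonCuts k H ℕ.* (a ℕ.^ k ℕ.* b ℕ.^ (m ∸ k)))
                           ≤ ∑≤ m (λ k → nonCuts k U ℕ.* (a ℕ.^ k ℕ.* b ℕ.^ (m ∸ k)))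
    weighted-nonCuts-≤ a b a+b≡1+s =
      cancel-c^ m (subst₂ ℚ._≤_ (at-ρ H H-edges) (at-ρ U U-edges) (H≤U ρ (toℚ*c-nonNeg a) ρ≤1))
      where
      open AtRatio a b a+b≡1+s
      at-ρ : ∀ X → edgeCount X ≡ m →
             R X ρ ≡ toℚ (∑≤ m (λ k → nonCuts k X ℕ.* (a ℕ.^ k ℕ.* b ℕ.^ (m ∸ k)))) * c ^ℚ m
      at-ρ X refl = reliability-at-ρ X

    nonCuts-≤-if-agree-above : ∀ k → k ≤ m → (∀ l → k ℕ.< l → l ≤ m → nonCuts l U ≡ nonCuts l H) →
                               nonCuts k H ≤ nonCuts k U
    nonCuts-≤-if-agree-above k k≤m agree =
      poly-≤⇒coeff-≤ m k (λ l → nonCuts l U) (λ l → nonCuts l H) k≤m H≤U-poly agree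
      where
      as-poly : ∀ X y → ∑≤ m (λ k → nonCuts k X ℕ.* (y ℕ.^ k ℕ.* 1 ℕ.^ (m ∸ k))) ≡ poly m (λ k → nonCuts k X) y
      as-poly X y = ∑≤-cong m (λ k _ → cong (nonCuts k X ℕ.*_)
                                           (trans (cong (y ℕ.^ k ℕ.*_) (ℕ.^-zeroˡ (m ∸ k))) (ℕ.*-identityʳ _)))
      H≤U-poly : ∀ y → poly m (λ l → nonCuts l H) y ≤ poly m (λ l → nonCuts l U) y
      H≤U-poly y = subst₂ _≤_ (as-poly H y) (as-poly U y) (weighted-nonCuts-≤ y 1 (ℕ.+-comm y 1))

    nonCuts-≤-if-agree-below : ∀ k → k ≤ m → (∀ l → l ℕ.< k → nonCuts l U ≡ nonCuts l H) →
                               nonCuts k H ≤ nonCuts k U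
    nonCuts-≤-if-agree-below k k≤m agree =
      subst (λ j → nonCuts j H ≤ nonCuts j U) (ℕ.m∸[m∸n]≡n k≤m)
        (poly-≤⇒coeff-≤ m (m ∸ k) (reversed U) (reversed H) (ℕ.m∸n≤m m k) H≤U-poly
          (λ j m∸k<j j≤m → agree (m ∸ j) (subst (m ∸ j ℕ.<_) (ℕ.m∸[m∸n]≡n k≤m) (ℕ.∸-monoʳ-< m∸k<j j≤m))))
      where
      reversed : Graph n → ℕ → ℕ
      reversed X j = nonCuts (m ∸ j) X
      as-poly : ∀ X y → ∑≤ m (λ k → nonCuts k X ℕ.* (1 ℕ.^ k ℕ.* y ℕ.^ (m ∸ k))) ≡ poly m (reversed X) y
      as-poly X y = begin
        ∑≤ m (λ k → nonCuts k X ℕ.* (1 ℕ.^ k ℕ.* y ℕ.^ (m ∸ k)))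
          ≡⟨ ∑≤-cong m (λ k _ → cong (λ z → nonCuts k X ℕ.* (z ℕ.* y ℕ.^ (m ∸ k))) (ℕ.^-zeroˡ k)) ⟩
        ∑≤ m (λ k → nonCuts k X ℕ.* (1 ℕ.* y ℕ.^ (m ∸ k)))
          ≡⟨ ∑≤-reverse m (λ k → nonCuts k X ℕ.* (1 ℕ.* y ℕ.^ (m ∸ k))) ⟨
        ∑≤ m (λ j → nonCuts (m ∸ j) X ℕ.* (1 ℕ.* y ℕ.^ (m ∸ (m ∸ j))))
          ≡⟨ ∑≤-cong m (λ j j≤m → cong (λ z → nonCuts (m ∸ j) X ℕ.* z)
                                       (trans (ℕ.*-identityˡ _) (cong (y ℕ.^_) (ℕ.m∸[m∸n]≡n j≤m)))) ⟩
        poly m (reversed X) y ∎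
        where open ≡-Reasoning
      H≤U-poly : ∀ y → poly m (reversed H) y ≤ poly m (reversed U) y
      H≤U-poly y = subst₂ _≤_ (as-poly H y) (as-poly U y) (weighted-nonCuts-≤ 1 y refl)

open Reliability

module EdgeCuts where

  open import Data.Bool using (Bool; true; false; _∧_; T)
  open import Data.Bool.Properties using (T-≡; T-∧)
  open import Data.Nat
  open import Data.Nat.Properties
  open import Data.Nat.Combinatorics using (_C_)
  open import Data.List using (map)
  open import Data.List.Membership.Propositional.Properties using (∈-map⁺)
  open import Data.Product using (_,_)
  open import Function using (Equivalence)
  open import Relation.Nullary.Decidable using (dec-false)
  open import Relation.Binary.PropositionalEquality

  μ+nonCuts≡C : ∀ {n} k (X : Graph n) → μ k X + nonCuts k X ≡ edgeCount X C k
  μ+nonCuts≡C k X = begin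
    μ k X + nonCuts k X
      ≡⟨ countᵇ-partition connected removes-k (subgraphs X) ⟩
    countᵇ removes-k (map mkGraph (subs (edgeVec X)))
      ≡⟨ countᵇ-map removes-k mkGraph (subs (edgeVec X)) ⟩
    countᵇ (λ w → (countT (edgeVec X) ∸ countT w) ≡ᵇ k) (subs (edgeVec X))
      ≡⟨ subs-binomial (edgeVec X) k ⟩
    edgeCount X C k ∎
    where
    open ≡-Reasoning
    removes-k : Graph _ → Bool
    removes-k S = (edgeCount X ∸ edgeCount S) ≡ᵇ k

  μ₀≡0 : ∀ {n} (X : Graph n) → T (connected X) → μ 0 X ≡ 0
  μ₀≡0 X X-connected = n≤0⇒n≡0 (+-cancelʳ-≤ 1 (μ 0 X) 0 (begin
    μ 0 X + 1           ≤⟨ +-monoʳ-≤ (μ 0 X) X-uncut ⟩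
    μ 0 X + nonCuts 0 X ≡⟨ μ+nonCuts≡C 0 X ⟩
    1                   ∎))
    where
    open ≤-Reasoning
    X-uncut : 1 ≤ nonCuts 0 X
    X-uncut = countᵇ-pos (∈-map⁺ mkGraph (∈-subs-self (edgeVec X)))
                         (Equivalence.from (T-∧ {connected X}) (X-connected , ≡⇒≡ᵇ _ 0 (n∸n≡0 (edgeCount X))))

  m∸[n∸1]≤m∸n+1 : ∀ m n → m ∸ (n ∸ 1) ≤ m ∸ n + 1
  m∸[n∸1]≤m∸n+1 m n = m≤n+o⇒m∸n≤o m (n ∸ 1) (begin
    m                           ≤⟨ m≤n+m∸n m n ⟩
    n + (m ∸ n)                 ≤⟨ +-monoˡ-≤ (m ∸ n) (m≤n+m∸n n 1) ⟩
    suc (n ∸ 1 + (m ∸ n))       ≡⟨ trans (cong (n ∸ 1 +_) (+-comm (m ∸ n) 1)) (+-suc (n ∸ 1) (m ∸ n)) ⟨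
    n ∸ 1 + (m ∸ n + 1)         ∎)
    where open ≤-Reasoning

  nonCuts-vanish : ∀ {n} (X : Graph n) k → edgeCount X ∸ n + 1 < k → nonCuts k X ≡ 0
  nonCuts-vanish {n} X k t<k = trans (countᵇ-cong never (subgraphs X)) (countᵇ-none (subgraphs X))
    where
    never : ∀ S → (connected S ∧ ((edgeCount X ∸ edgeCount S) ≡ᵇ k)) ≡ false
    never S with connected S in S-connected
    ... | false = refl
    ... | true  = dec-false (edgeCount X ∸ edgeCount S ≟ k) (λ removed≡k → <⇒≱ t<k (begin
      k                                ≡⟨ removed≡k ⟨
      edgeCount X ∸ edgeCount S        ≤⟨ ∸-monoʳ-≤ (edgeCount X) (connected⇒n∸1≤edgeCount S S-connected′) ⟩
      edgeCount X ∸ (n ∸ 1)            ≤⟨ m∸[n∸1]≤m∸n+1 (edgeCount X) n ⟩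
      edgeCount X ∸ n + 1              ∎))
      where
      open ≤-Reasoning
      S-connected′ : T (connected S)
      S-connected′ = Equivalence.from T-≡ S-connected

  TOptimal-iso : ∀ {n m} {G U : Graph n} → Iso G U → TOptimal n m U → TOptimal n m G
  TOptimal-iso {n} {m} {G} {U} G≅U U-t-optimal H H∈C =
    subst (_≤ μ (m ∸ n + 1) H) (sym (μ-iso (m ∸ n + 1) {G} {U} G≅U)) (U-t-optimal H H∈C)

open EdgeCuts

module MostReliable where

  open import Data.Bool using (T)
  open import Data.Bool.Properties using (T-≡)
  open import Data.Nat
  open import Data.Nat.Properties
  open import Data.Rational as ℚ using (ℚ; 0ℚ; 1ℚ)
  open import Data.Nat.Combinatorics using (_C_; k>n⇒nCk≡0)
  open import Data.Product using (_,_; proj₁; proj₂)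
  open import Data.Sum using (inj₁; inj₂)
  open import Function using (Equivalence)
  open import Relation.Nullary using (yes; no)
  open import Relation.Binary.PropositionalEquality

  module _ {n m : ℕ} where

    InCi⇒InC : ∀ i {X : Graph n} → InCi n m i X → InC n m X
    InCi⇒InC zero    X∈C  = X∈C
    InCi⇒InC (suc i) X∈Cⁱ = InCi⇒InC i (proj₁ X∈Cⁱ)

    InCi-antitone : ∀ {l i} {X : Graph n} → l ≤ i → InCi n m i X → InCi n m l X
    InCi-antitone {l} {i} l≤i X∈Cⁱ with m≤n⇒m<n∨m≡n l≤i
    ... | inj₂ refl = X∈Cⁱ
    InCi-antitone {l} {suc i} _ X∈Cⁱ | inj₁ (s≤s l≤i) = InCi-antitone l≤i (proj₁ X∈Cⁱ)

    InCi-μ≡ : ∀ {i} {X Y : Graph n} → InCi n m i X → InCi n m i Y → ∀ l → l ≤ i → μ l X ≡ μ l Y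
    InCi-μ≡ {i} {X} {Y} X∈Cⁱ Y∈Cⁱ zero _ = trans (μ₀≡0 X (connected-T X∈Cⁱ)) (sym (μ₀≡0 Y (connected-T Y∈Cⁱ)))
      where
      connected-T : ∀ {Z} → InCi n m i Z → T (connected Z)
      connected-T Z∈Cⁱ = Equivalence.from T-≡ (proj₁ (InCi⇒InC i Z∈Cⁱ))
    InCi-μ≡ X∈Cⁱ Y∈Cⁱ (suc l) l<i = ≤-antisym
      (proj₂ (InCi-antitone l<i X∈Cⁱ) _ (InCi-antitone (<⇒≤ l<i) Y∈Cⁱ))
      (proj₂ (InCi-antitone l<i Y∈Cⁱ) _ (InCi-antitone (<⇒≤ l<i) X∈Cⁱ))

    InC-μ+nonCuts≡ : ∀ k {X Y : Graph n} → InC n m X → InC n m Y → μ k X + nonCuts k X ≡ μ k Y + nonCuts k Y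
    InC-μ+nonCuts≡ k {X} {Y} (_ , X-edges) (_ , Y-edges) = begin
      μ k X + nonCuts k X ≡⟨ μ+nonCuts≡C k X ⟩
      edgeCount X C k     ≡⟨ cong (_C k) (trans X-edges (sym Y-edges)) ⟩
      edgeCount Y C k     ≡⟨ μ+nonCuts≡C k Y ⟨
      μ k Y + nonCuts k Y ∎
      where open ≡-Reasoning

    InC-nonCuts≡ : ∀ {k} {X Y : Graph n} → InC n m X → InC n m Y → μ k X ≡ μ k Y → nonCuts k X ≡ nonCuts k Y
    InC-nonCuts≡ {k} {X} {Y} X∈C Y∈C μX≡μY =
      +-cancelˡ-≡ (μ k X) _ _ (trans (InC-μ+nonCuts≡ k X∈C Y∈C) (cong (_+ nonCuts k Y) (sym μX≡μY)))

    InC-μ-≤ : ∀ {k} {X Y : Graph n} → InC n m X → InC n m Y → nonCuts k Y ≤ nonCuts k X → μ k X ≤ μ k Y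
    InC-μ-≤ {k} {X} {Y} X∈C Y∈C Y≤X = +-cancelʳ-≤ (nonCuts k X) (μ k X) (μ k Y)
      (subst (_≤ μ k Y + nonCuts k X) (sym (InC-μ+nonCuts≡ k X∈C Y∈C)) (+-monoʳ-≤ (μ k Y) Y≤X))

  module _ {n m : ℕ} {U : Graph n} (U-umr : UMR n m U) where

    private
      U∈C : InC n m U
      U∈C = proj₁ U-umr
      U-best : (H : Graph n) → InC n m H → (ρ : ℚ) → 0ℚ ℚ.≤ ρ → ρ ℚ.≤ 1ℚ → R H ρ ℚ.≤ R U ρ
      U-best = proj₂ U-umr

    UMR⇒InCi : ∀ i → i ≤ m → InCi n m i U
    UMR⇒InCi zero    _   = U∈C
    UMR⇒InCi (suc i) i<m = U∈Cⁱ , μ-minimal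
      where
      U∈Cⁱ : InCi n m i U
      U∈Cⁱ = UMR⇒InCi i (<⇒≤ i<m)
      μ-minimal : ∀ H → InCi n m i H → μ (suc i) U ≤ μ (suc i) H
      μ-minimal H H∈Cⁱ = InC-μ-≤ {X = U} {H} U∈C H∈C
        (nonCuts-≤-if-agree-below {H = H} {U} (proj₂ H∈C) (proj₂ U∈C) (U-best H H∈C) (suc i) i<m
          (λ l l≤i → InC-nonCuts≡ {X = U} {H} U∈C H∈C (InCi-μ≡ U∈Cⁱ H∈Cⁱ l (≤-pred l≤i))))
        where
        H∈C : InC n m H
        H∈C = InCi⇒InC i H∈Cⁱ

    UMR⇒TOptimal : TOptimal n m U
    UMR⇒TOptimal H H∈C with m ∸ n + 1 ≤? m
    ... | yes t≤m = InC-μ-≤ {X = U} {H} U∈C H∈C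
        (nonCuts-≤-if-agree-above {H = H} {U} (proj₂ H∈C) (proj₂ U∈C) (U-best H H∈C) (m ∸ n + 1) t≤m
          (λ l t<l _ → trans (vanish U∈C t<l) (sym (vanish H∈C t<l))))
      where
      vanish : ∀ {X l} → InC n m X → m ∸ n + 1 < l → nonCuts l X ≡ 0
      vanish {X} {l} (_ , refl) = nonCuts-vanish X l
    ... | no  t≰m = subst (_≤ μ (m ∸ n + 1) H) (sym μU≡0) z≤n
      where
      μU≡0 : μ (m ∸ n + 1) U ≡ 0
      μU≡0 = m+n≡0⇒m≡0 _ (trans (μ+nonCuts≡C (m ∸ n + 1) U)
                              (trans (cong (_C (m ∸ n + 1)) (proj₂ U∈C)) (k>n⇒nCk≡0 (≰⇒> t≰m))))

open MostReliable

lemma1 : (n m : ℕ) → 1 ≤ n → 1 ≤ m → Σ (Graph n) (InC n m)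
    → (j : ℕ) → 1 ≤ j → j ≤ m
    → (G : Graph n) → InCi n m j G → ((H : Graph n) → InCi n m j H → Iso G H)
    → ¬ TOptimal n m G
    → ¬ Σ (Graph n) (UMR n m)
lemma1 n m _ _ _ j _ j≤m G _ Cʲ≅G G-not-t-optimal (U , U-umr) =
  G-not-t-optimal (TOptimal-iso {G = G} {U} (Cʲ≅G U (UMR⇒InCi U-umr j j≤m)) (UMR⇒TOptimal U-umr))
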